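{- Let $n,k>1$ be integers. Set $X=[0,n]$, $m=(2k+3)n$, $Y=m-X=\{m-x : x\in X\}$, $Z=\bigsqcup_{j=1}^{k}[2jn+1,(2j+1)n-1]$, $B=X\sqcup Y\sqcup Z$, $a=2n$, and $A=B\sqcup\{a\}$. Then $|A+A|-|A-A|=1$. Furthermore, set $W=[(2k+4)n,(2k+5)n)$ and $\mathcal{A}=A\sqcup W$. Then $|\mathcal{A}+\mathcal{A}|-|\mathcal{A}-\mathcal{A}|=2$.
   Context: All intervals denote sets of integers, e.g. $[x,y]=\{z\in\mathbb{Z}: x\le z\le y\}$ and $[x,y)=\{z\in\mathbb{Z} : x\le z<y\}$. For $A\subseteq\mathbb{Z}$, $A+A=\{a_1+a_2 : a_1,a_2\in A\}$ and $A-A=\{a_1-a_2 : a_1,a_2\in A\}$. -}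

module Defs where

open import Data.Nat as ℕ using (ℕ; suc; _∸_)
open import Data.Integer as ℤ using (ℤ; +_; _+_; _-_)
open import Data.List using (List; []; _∷_; _++_; map; concatMap; length; upTo; deduplicate)

-- Finite sets of integers are represented by lists (duplicates allowed);
-- the set denoted by a list is its set of elements.

card : List ℤ → ℕ
card S = length (deduplicate ℤ._≟_ S)

sumset : List ℤ → List ℤ
sumset S = concatMap (λ s₁ → map (λ s₂ → s₁ + s₂) S) S

diffset : List ℤ → List ℤ
diffset S = concatMap (λ s₁ → map (λ s₂ → s₁ - s₂) S) S

interval : ℕ → ℕ → List ℤ
interval a b = map (λ i → + (a ℕ.+ i)) (upTo (suc b ∸ a))

module Construction (n k : ℕ) where
  X : List ℤ
  X = interval 0 n

  m : ℕ
  m = (2 ℕ.* k ℕ.+ 3) ℕ.* n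

  Y : List ℤ
  Y = map (λ x → + m - x) X

  Zpart : ℕ → List ℤ
  Zpart j = interval (2 ℕ.* j ℕ.* n ℕ.+ 1) ((2 ℕ.* j ℕ.+ 1) ℕ.* n ∸ 1)

  Z : List ℤ
  Z = concatMap Zpart (map suc (upTo k))

  B : List ℤ
  B = X ++ Y ++ Z

  a : ℤ
  a = + (2 ℕ.* n)

  A : List ℤ
  A = B ++ (a ∷ [])

  W : List ℤ
  W = interval ((2 ℕ.* k ℕ.+ 4) ℕ.* n) ((2 ℕ.* k ℕ.+ 5) ℕ.* n ∸ 1)

  𝒜 : List ℤ
  𝒜 = A ++ W

-- Write every element of A (and of 𝒜) as 2cn + t with 0 ≤ t ≤ n.  Reducing a sum or difference of
-- two such numbers modulo n shows which multiples of n it can hit; conversely every other candidate,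
-- written as 2jn + r or 2jn + n + r with r < n, has explicit summands found by cases on j.  This gives
--   A + A = [0, 2m] minus {2jn : 3 ≤ j ≤ k or k + 3 ≤ j ≤ 2k + 1},
--   A − A = [−m, m] minus {±(2i + 1)n : 1 ≤ i ≤ k − 1},
-- so both are an interval of 2m + 1 integers with holes, 2k − 3 of them in A + A and 2k − 2 in A − A.
-- For 𝒜 the same holds with m replaced by max 𝒜 = (2k + 5)n − 1, except that 2(k + 3)n = a + min W is
-- no longer a hole of the sumset, which leaves 2k − 4 holes in 𝒜 + 𝒜 against 2k − 2 in 𝒜 − 𝒜.

module Submission where

open import Defs
open import Data.Nat
open import Data.Nat.Properties
open import Data.Nat.DivMod using (_/_; _%_; m≡m%n+[m/n]*n; m%n<n)
open import Data.Nat.Tactic.RingSolver using (solve-∀)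
open import Data.Bool using (Bool; true; false; if_then_else_)
open import Data.Integer as ℤ using (ℤ; +_; -[1+_]; ∣_∣; _-_)
import Data.Integer.Properties as ℤ
open import Data.List using (List; _∷_; _++_; map; length; upTo; deduplicate)
open import Data.List.Properties using (length-++; length-map; length-upTo; map-∘)
open import Data.List.Membership.Propositional using (_∈_; _∉_; lose; find)
open import Data.List.Membership.Propositional.Properties
  using (∈-map⁺; ∈-map⁻; ∈-++⁺ˡ; ∈-++⁺ʳ; ∈-++⁻; ∈-upTo⁺; ∈-upTo⁻; ∈-concatMap⁺; ∈-concatMap⁻;
         ∈-deduplicate⁺; ∈-deduplicate⁻)
open import Data.List.Membership.Propositional.Properties.WithK using (unique∧set⇒bag)
open import Data.List.Membership.DecPropositional ℤ._≟_ using (_∈?_)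
open import Data.List.Relation.Binary.BagAndSetEquality using (∼bag⇒↭)
open import Data.List.Relation.Binary.Permutation.Propositional.Properties using (↭-length)
import Data.List.Relation.Unary.All as All
open import Data.List.Relation.Unary.Any using (here; there)
open import Data.List.Relation.Unary.Unique.Propositional using (Unique; _∷_)
open import Data.List.Relation.Unary.Unique.Propositional.Properties using (map⁺; ++⁺; upTo⁺)
open import Data.List.Relation.Unary.Unique.DecPropositional.Properties ℤ._≟_ using (deduplicate-!)
open import Data.Empty using (⊥-elim)
open import Data.Product using (_×_; _,_; proj₁; proj₂; ∃-syntax)
open import Data.Product.Relation.Binary.Lex.Strict using (×-Lex)
open import Data.Sum using (_⊎_; inj₁; inj₂)
open import Function using (_∘_; mk⇔)
open import Relation.Binary.Definitions using (tri<; tri≈; tri>)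
open import Relation.Binary.PropositionalEquality
open import Relation.Nullary using (¬_; yes; no)

<⇒≤∸1 : ∀ {m n} → m < n → m ≤ n ∸ 1
<⇒≤∸1 (s≤s m≤n) = m≤n

≤∸1⇒< : ∀ {m n} → 0 < n → m ≤ n ∸ 1 → m < n
≤∸1⇒< {n = suc n} _ = s≤s

_≤ₗ_ : ℕ × ℕ → ℕ × ℕ → Set
_≤ₗ_ = ×-Lex _≡_ _<_ _≤_

[+x]-[+y]≡+d : ∀ {x y d} → x ≡ y + d → + x ℤ.- + y ≡ + d
[+x]-[+y]≡+d {y = y} {d} refl =
  trans (ℤ.[+m]-[+n]≡m⊖n (y + d) y) (trans (ℤ.⊖-≥ (m≤m+n y d)) (cong +_ (m+n∸m≡n y d)))

[+y]-[+x]≡-d : ∀ {x y d} → x ≡ y + d → + y ℤ.- + x ≡ ℤ.- + d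
[+y]-[+x]≡-d {y = y} {d} refl =
  trans (ℤ.[+m]-[+n]≡m⊖n y (y + d)) (trans (ℤ.⊖-≤ (m≤m+n y d)) (cong (λ e → ℤ.- + e) (m+n∸m≡n y d)))

+a-+b≡+δ : ∀ {a b h δ N} → a + h ≡ N → b + (h + δ) ≡ N → + a ℤ.- + b ≡ + δ
+a-+b≡+δ {a} {b} {h} {δ} a+h≡N b+h+δ≡N = [+x]-[+y]≡+d (+-cancelʳ-≡ h a (b + δ) (trans a+h≡N (sym b+δ+h≡N)))
  where
  b+δ+h≡N : b + δ + h ≡ _
  b+δ+h≡N = trans (+-assoc b δ h) (trans (cong (_+_ b) (+-comm δ h)) b+h+δ≡N)

±∣z∣ : ∀ z → z ≡ + ∣ z ∣ ⊎ z ≡ ℤ.- + ∣ z ∣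
±∣z∣ (+ d) = inj₁ refl
±∣z∣ -[1+ d ] = inj₂ refl

-- range a c lists the c numbers a, a + 1, …, a + c - 1 (c is a length, not an endpoint).
range : ℕ → ℕ → List ℕ
range a c = map (_+_ a) (upTo c)

∈-range⁻ : ∀ {a c j} → j ∈ range a c → a ≤ j × j < a + c
∈-range⁻ {a} j∈ with ∈-map⁻ (_+_ a) j∈
... | i , i∈ , refl = m≤m+n a i , +-monoʳ-< a (∈-upTo⁻ i∈)

∈-range⁺ : ∀ {a c j} → a ≤ j → j < a + c → j ∈ range a c
∈-range⁺ {a} {c} {j} a≤j j<a+c = subst (_∈ range a c) (m+[n∸m]≡n a≤j)
  (∈-map⁺ (_+_ a) (∈-upTo⁺ (+-cancelˡ-< a _ c (subst (_< a + c) (sym (m+[n∸m]≡n a≤j)) j<a+c))))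

range-unique : ∀ a c → Unique (range a c)
range-unique a c = map⁺ (+-cancelˡ-≡ a _ _) (upTo⁺ c)

length-range : ∀ a c → length (range a c) ≡ c
length-range a c = trans (length-map (_+_ a) (upTo c)) (length-upTo c)

∈-interval⁻ : ∀ {a b z} → z ∈ interval a b → ∃[ x ] (a ≤ x × x ≤ b × z ≡ + x)
∈-interval⁻ {a} {b} z∈ with ∈-map⁻ +_ (subst (_ ∈_) (map-∘ (upTo (suc b ∸ a))) z∈)
... | x , x∈ , z≡ with ∈-range⁻ x∈
...   | a≤x , x<a+c = x , a≤x , s≤s⁻¹ (subst (x <_) (m+[n∸m]≡n (<⇒≤ (m∸n≢0⇒n<m {n = a} c≢0))) x<a+c) , z≡
  where
  c≢0 : suc b ∸ a ≢ 0
  c≢0 c≡0 = <⇒≱ (subst (x <_) (trans (cong (_+_ a) c≡0) (+-identityʳ a)) x<a+c) a≤x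

∈-interval⁺ : ∀ {a b x} → a ≤ x → x ≤ b → + x ∈ interval a b
∈-interval⁺ {a} {b} {x} a≤x x≤b = subst (_ ∈_) (sym (map-∘ (upTo (suc b ∸ a))))
  (∈-map⁺ +_ (∈-range⁺ a≤x (subst (x <_) (sym (m+[n∸m]≡n (≤-trans a≤x (m≤n⇒m≤1+n x≤b)))) (s≤s x≤b))))

interval-unique : ∀ a b → Unique (interval a b)
interval-unique a b = subst Unique (sym (map-∘ (upTo (suc b ∸ a)))) (map⁺ ℤ.+-injective (range-unique a _))

length-interval : ∀ a b → length (interval a b) ≡ suc b ∸ a
length-interval a b = trans (length-map _ (upTo (suc b ∸ a))) (length-upTo _)

signed : List ℕ → List ℤ
signed ds = map +_ ds ++ map (λ d → ℤ.- + d) ds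

∈-signed⁻ : ∀ {ds z} → z ∈ signed ds → ∣ z ∣ ∈ ds
∈-signed⁻ {ds} z∈ with ∈-++⁻ (map +_ ds) z∈
... | inj₁ p with ∈-map⁻ +_ p
...   | d , d∈ , refl = d∈
∈-signed⁻ {ds} z∈ | inj₂ p with ∈-map⁻ (λ d → ℤ.- + d) p
...   | d , d∈ , refl = subst (_∈ ds) (sym (ℤ.∣-i∣≡∣i∣ (+ d))) d∈

∈-signed⁺ : ∀ {ds z} → ∣ z ∣ ∈ ds → z ∈ signed ds
∈-signed⁺ {ds} {+ d} d∈ = ∈-++⁺ˡ (∈-map⁺ +_ d∈)
∈-signed⁺ {ds} { -[1+ d ]} d∈ = ∈-++⁺ʳ (map +_ ds) (∈-map⁺ (λ d → ℤ.- + d) d∈)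

signed-unique : ∀ {ds} → Unique ds → 0 ∉ ds → Unique (signed ds)
signed-unique {ds} u 0∉ = ++⁺ (map⁺ ℤ.+-injective u) (map⁺ (ℤ.+-injective ∘ ℤ.neg-injective) u) disjoint
  where
  disjoint : ∀ {z} → ¬ (z ∈ map +_ ds × z ∈ map (λ d → ℤ.- + d) ds)
  disjoint (p , q) with ∈-map⁻ +_ p | ∈-map⁻ (λ d → ℤ.- + d) q
  ... | _ , _ , refl | zero , 0∈ , _ = 0∉ 0∈
  ... | _ , _ , refl | suc _ , _ , ()

length-signed : ∀ ds → length (signed ds) ≡ length ds + length ds
length-signed ds = trans (length-++ (map +_ ds)) (cong₂ _+_ (length-map +_ ds) (length-map _ ds))

card-complement : ∀ {S H I : List ℤ} → Unique H → Unique I →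
  (∀ {z} → z ∈ S → z ∉ H) → (∀ {z} → z ∈ S → z ∈ I) → (∀ {z} → z ∈ H → z ∈ I) →
  (∀ {z} → z ∈ I → z ∉ H → z ∈ S) →
  card S + length H ≡ length I
card-complement {S} {H} {I} uH uI S∌H S⊆I H⊆I I∖H⊆S =
  trans (sym (length-++ S′)) (↭-length (∼bag⇒↭ (unique∧set⇒bag uS′H uI (mk⇔ to from))))
  where
  S′ = deduplicate ℤ._≟_ S
  uS′H : Unique (S′ ++ H)
  uS′H = ++⁺ (deduplicate-! S) uH (λ (p , q) → S∌H (∈-deduplicate⁻ ℤ._≟_ S p) q)
  to : ∀ {z} → z ∈ S′ ++ H → z ∈ I
  to z∈ with ∈-++⁻ S′ z∈
  ... | inj₁ p = S⊆I (∈-deduplicate⁻ ℤ._≟_ S p)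
  ... | inj₂ q = H⊆I q
  from : ∀ {z} → z ∈ I → z ∈ S′ ++ H
  from {z} z∈ with z ∈? H
  ... | yes q = ∈-++⁺ʳ S′ q
  ... | no z∉ = ∈-++⁺ˡ (∈-deduplicate⁺ ℤ._≟_ (I∖H⊆S z∈ z∉))

∈-sumset⁻ : ∀ {S z} → z ∈ sumset S → ∃[ x ] ∃[ y ] (x ∈ S × y ∈ S × z ≡ x ℤ.+ y)
∈-sumset⁻ {S} z∈ with find (∈-concatMap⁻ (λ x → map (λ y → x ℤ.+ y) S) {xs = S} z∈)
... | x , x∈ , p with ∈-map⁻ (λ y → x ℤ.+ y) p
...   | y , y∈ , e = x , y , x∈ , y∈ , e

∈-sumset⁺ : ∀ {S x y} → x ∈ S → y ∈ S → x ℤ.+ y ∈ sumset S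
∈-sumset⁺ {S} {x} x∈ y∈ = ∈-concatMap⁺ (λ x → map (λ y → x ℤ.+ y) S) (lose x∈ (∈-map⁺ (λ y → x ℤ.+ y) y∈))

∈-diffset⁻ : ∀ {S z} → z ∈ diffset S → ∃[ x ] ∃[ y ] (x ∈ S × y ∈ S × z ≡ x ℤ.- y)
∈-diffset⁻ {S} z∈ with find (∈-concatMap⁻ (λ x → map (λ y → x ℤ.- y) S) {xs = S} z∈)
... | x , x∈ , p with ∈-map⁻ (λ y → x ℤ.- y) p
...   | y , y∈ , e = x , y , x∈ , y∈ , e

∈-diffset⁺ : ∀ {S x y} → x ∈ S → y ∈ S → x ℤ.- y ∈ diffset S
∈-diffset⁺ {S} {x} x∈ y∈ = ∈-concatMap⁺ (λ x → map (λ y → x ℤ.- y) S) (lose x∈ (∈-map⁺ (λ y → x ℤ.- y) y∈))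

q*n+t≡q′*n+t′-cases : ∀ {n} .{{_ : NonZero n}} → ∀ q q′ {t t′} → t ≤ n → t′ ≤ n → q * n + t ≡ q′ * n + t′ →
  (q ≡ q′ × t ≡ t′) ⊎ (suc q ≡ q′ × t ≡ n × t′ ≡ 0) ⊎ (q ≡ suc q′ × t ≡ 0 × t′ ≡ n)
q*n+t≡q′*n+t′-cases zero zero _ _ eq = inj₁ (refl , eq)
q*n+t≡q′*n+t′-cases {n} zero (suc q′) {t} {t′} t≤n _ eq =
  inj₂ (inj₁ (cong suc (sym q′≡0) , trans eq′ (trans (cong (_+_ n) rest≡0) (+-identityʳ n)) ,
              m+n≡0⇒n≡0 (q′ * n) rest≡0))
  where
  eq′ : t ≡ n + (q′ * n + t′)
  eq′ = trans eq (+-assoc n (q′ * n) t′)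
  rest≡0 : q′ * n + t′ ≡ 0
  rest≡0 = n≤0⇒n≡0 (+-cancelˡ-≤ n _ 0 (subst (_≤ n + 0) eq′ (subst (t ≤_) (sym (+-identityʳ n)) t≤n)))
  q′≡0 : q′ ≡ 0
  q′≡0 = m*n≡0⇒m≡0 q′ n (m+n≡0⇒m≡0 (q′ * n) rest≡0)
q*n+t≡q′*n+t′-cases (suc q) zero t≤n t′≤n eq with q*n+t≡q′*n+t′-cases zero (suc q) t′≤n t≤n (sym eq)
... | inj₂ (inj₁ (e , t′≡n , t≡0)) = inj₂ (inj₂ (sym e , t≡0 , t′≡n))
q*n+t≡q′*n+t′-cases {n} (suc q) (suc q′) {t} {t′} t≤n t′≤n eq
  with q*n+t≡q′*n+t′-cases q q′ t≤n t′≤n (+-cancelˡ-≡ n _ _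
      (trans (sym (+-assoc n (q * n) t)) (trans eq (+-assoc n (q′ * n) t′))))
... | inj₁ (e , p) = inj₁ (cong suc e , p)
... | inj₂ (inj₁ (e , p)) = inj₂ (inj₁ (cong suc e , p))
... | inj₂ (inj₂ (e , p)) = inj₂ (inj₂ (cong suc e , p))

q*n+t≡p*n-cases : ∀ {n} .{{_ : NonZero n}} → ∀ q p {t} → t ≤ n + n → q * n + t ≡ p * n →
  (t ≡ 0 × q ≡ p) ⊎ (t ≡ n × suc q ≡ p) ⊎ (t ≡ n + n × suc (suc q) ≡ p)
q*n+t≡p*n-cases zero zero _ eq = inj₁ (eq , refl)
q*n+t≡p*n-cases {n} zero (suc zero) _ eq = inj₂ (inj₁ (trans eq (+-identityʳ n) , refl))
q*n+t≡p*n-cases {n} zero (suc (suc zero)) _ eq = inj₂ (inj₂ (trans eq (cong (_+_ n) (+-identityʳ n)) , refl))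
q*n+t≡p*n-cases {n} zero (suc (suc (suc p))) {t} t≤2n eq = ⊥-elim (<-irrefl refl (≤-trans 2n<t t≤2n))
  where
  2n<t : n + n < t
  2n<t = subst (n + n <_) (trans (+-assoc n n (n + p * n)) (sym eq))
    (m<m+n (n + n) (<-≤-trans (>-nonZero⁻¹ n) (m≤m+n n (p * n))))
q*n+t≡p*n-cases {suc _} (suc q) zero _ ()
q*n+t≡p*n-cases {n} (suc q) (suc p) {t} t≤2n eq
  with q*n+t≡p*n-cases q p t≤2n (+-cancelˡ-≡ n _ _ (trans (sym (+-assoc n (q * n) t)) eq))
... | inj₁ (e , f) = inj₁ (e , cong suc f)
... | inj₂ (inj₁ (e , f)) = inj₂ (inj₁ (e , cong suc f))
... | inj₂ (inj₂ (e , f)) = inj₂ (inj₂ (e , cong suc f))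

2jn+r⊎2jn+n+r : ∀ n .{{_ : NonZero n}} z →
  ∃[ j ] ∃[ r ] (r < n × (z ≡ 2 * j * n + r ⊎ z ≡ 2 * j * n + (n + r)))
2jn+r⊎2jn+n+r n z = split (z / (2 * n)) (z % (2 * n)) (m%n<n z (2 * n)) (m≡m%n+[m/n]*n z (2 * n))
  where
  instance _ = m*n≢0 2 n
  reorder : ∀ ρ j n → ρ + j * (2 * n) ≡ 2 * j * n + ρ
  reorder = solve-∀
  split : ∀ j ρ → ρ < 2 * n → z ≡ ρ + j * (2 * n) →
    ∃[ j ] ∃[ r ] (r < n × (z ≡ 2 * j * n + r ⊎ z ≡ 2 * j * n + (n + r)))
  split j ρ ρ<2n z≡ with ρ <? n
  ... | yes ρ<n = j , ρ , ρ<n , inj₁ (trans z≡ (reorder ρ j n))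
  ... | no ρ≮n = j , ρ ∸ n , m<n+o⇒m∸n<o ρ n (subst (ρ <_) (cong (_+_ n) (+-identityʳ n)) ρ<2n) ,
    inj₂ (trans z≡ (trans (reorder ρ j n) (cong (_+_ (2 * j * n)) (sym (m+[n∸m]≡n (≮⇒≥ ρ≮n))))))

-- Position of the window [2jn, 2jn + 2n) relative to the blocks X, Z₁, …, Z_k, Y, W and their pairwise sums.
data BlockIndex (k : ℕ) : ℕ → Set where
  j≡0 : BlockIndex k 0
  j≡1 : BlockIndex k 1
  2≤j≤k : ∀ {j} → 2 ≤ j → j ≤ k → BlockIndex k j
  j≡k+1 : BlockIndex k (suc k)
  j≡k+2 : BlockIndex k (suc (suc k))
  k+1+[2,k] : ∀ {i} → 2 ≤ i → i ≤ k → BlockIndex k (suc k + i)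
  j≡2k+2 : BlockIndex k (suc k + suc k)
  j≡2k+3 : BlockIndex k (suc k + suc k + 1)
  j≡2k+4 : BlockIndex k (suc k + suc k + 2)
  j≥2k+5 : ∀ d → BlockIndex k (suc k + suc k + 3 + d)

blockIndex : ∀ k j → BlockIndex k j
blockIndex k j with j ≤? k
blockIndex k zero | yes _ = j≡0
blockIndex k (suc zero) | yes _ = j≡1
blockIndex k (suc (suc j)) | yes j≤k = 2≤j≤k (s≤s (s≤s z≤n)) j≤k
... | no j≰k with m≤n⇒∃[o]m+o≡n (≰⇒> j≰k)
... | zero , refl = subst (BlockIndex k) (sym (+-identityʳ (suc k))) j≡k+1
... | suc zero , refl = subst (BlockIndex k) (+-comm 1 (suc k)) j≡k+2
... | suc (suc i) , refl with suc (suc i) ≤? k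
...   | yes i≤k = k+1+[2,k] (s≤s (s≤s z≤n)) i≤k
...   | no i≰k with m≤n⇒∃[o]m+o≡n (≰⇒> i≰k)
...     | zero , e = subst (λ i → BlockIndex k (suc k + i)) (trans (sym (+-identityʳ (suc k))) e) j≡2k+2
...     | suc zero , e = subst (λ i → BlockIndex k (suc k + i)) e
          (subst (BlockIndex k) (+-assoc (suc k) (suc k) 1) j≡2k+3)
...     | suc (suc zero) , e = subst (λ i → BlockIndex k (suc k + i)) e
          (subst (BlockIndex k) (+-assoc (suc k) (suc k) 2) j≡2k+4)
...     | suc (suc (suc d)) , e = subst (λ i → BlockIndex k (suc k + i)) e
          (subst (BlockIndex k) (shift k d) (j≥2k+5 d))
  where
  shift : ∀ k d → suc k + suc k + 3 + d ≡ suc k + (suc k + suc (suc (suc d)))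
  shift = solve-∀

module _ (n k : ℕ) (2≤n : 2 ≤ n) (2≤k : 2 ≤ k) where

  private module C = Construction n k

  instance
    n≢0 : NonZero n
    n≢0 = >-nonZero (≤-trans (s≤s z≤n) 2≤n)

  0<n : 0 < n
  0<n = >-nonZero⁻¹ n

  pt : ℕ → ℕ → ℕ
  pt c t = 2 * c * n + t

  pt+pt≡pt : ∀ c₁ t₁ c₂ t₂ → pt c₁ t₁ + pt c₂ t₂ ≡ pt (c₁ + c₂) (t₁ + t₂)
  pt+pt≡pt c₁ t₁ c₂ t₂ = regroup c₁ c₂ t₁ t₂ n
    where
    regroup : ∀ c₁ c₂ t₁ t₂ n → 2 * c₁ * n + t₁ + (2 * c₂ * n + t₂) ≡ 2 * (c₁ + c₂) * n + (t₁ + t₂)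
    regroup = solve-∀

  -- Pos b c t : the number pt c t lies in A (b = false) or in 𝒜 (b = true);
  -- inZ₁ with t = 0 is the extra element a = 2n.
  data Pos : Bool → ℕ → ℕ → Set where
    inX : ∀ {b t} → t ≤ n → Pos b 0 t
    inZ₁ : ∀ {b t} → t < n → Pos b 1 t
    inZ : ∀ {b j t} → 2 ≤ j → j ≤ k → 1 ≤ t → t < n → Pos b j t
    inY : ∀ {b t} → t ≤ n → Pos b (suc k) t
    inW : ∀ {t} → t < n → Pos true (suc (suc k)) t

  Pos-A⊆𝒜 : ∀ {c t} → Pos false c t → Pos true c t
  Pos-A⊆𝒜 (inX p) = inX p
  Pos-A⊆𝒜 (inZ₁ p) = inZ₁ p
  Pos-A⊆𝒜 (inZ p q r s) = inZ p q r s
  Pos-A⊆𝒜 (inY p) = inY p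

  Pos⇒t≤n : ∀ {b c t} → Pos b c t → t ≤ n
  Pos⇒t≤n (inX p) = p
  Pos⇒t≤n (inZ₁ p) = <⇒≤ p
  Pos⇒t≤n (inZ _ _ _ p) = <⇒≤ p
  Pos⇒t≤n (inY p) = p
  Pos⇒t≤n (inW p) = <⇒≤ p

  -- For 𝒜 the hole 2(k + 3)n disappears: it is a + min W.
  SumHole : Bool → ℕ → Set
  SumHole b j = (3 ≤ j × j ≤ k) ⊎ (k + 3 + (if b then 1 else 0) ≤ j × j ≤ k + k + 1)

  DiffHole : ℕ → Set
  DiffHole i = 1 ≤ i × i < k

  small-not-hole : ∀ {b j} → j ≤ 2 → ¬ SumHole b j
  small-not-hole j≤2 (inj₁ (3≤j , _)) = 1+n≰n (≤-trans 3≤j j≤2)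
  small-not-hole {b} j≤2 (inj₂ (lo≤j , _)) =
    1+n≰n (≤-trans (≤-trans (m≤n+m 3 k) (m≤m+n (k + 3) _)) (≤-trans lo≤j j≤2))

  middle-not-hole : ∀ {b j} → k < j → j < k + 3 + (if b then 1 else 0) → ¬ SumHole b j
  middle-not-hole k<j _ (inj₁ (_ , j≤k)) = ≤⇒≯ j≤k k<j
  middle-not-hole _ j<lo (inj₂ (lo≤j , _)) = ≤⇒≯ lo≤j j<lo

  SumHole⇒j≤2k+1 : ∀ {b j} → SumHole b j → j ≤ k + k + 1
  SumHole⇒j≤2k+1 (inj₁ (_ , j≤k)) = ≤-trans j≤k (≤-trans (m≤m+n k k) (m≤m+n (k + k) 1))
  SumHole⇒j≤2k+1 (inj₂ (_ , j≤2k+1)) = j≤2k+1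

  large-not-hole : ∀ {b j} → suc k + suc k ≤ j → ¬ SumHole b j
  large-not-hole 2k+2≤j hole = ≤⇒≯ (SumHole⇒j≤2k+1 hole) (≤-trans (≤-reflexive (2k+2 k)) 2k+2≤j)
    where
    2k+2 : ∀ k → suc (k + k + 1) ≡ suc k + suc k
    2k+2 = solve-∀

  k+1-not-hole : ∀ {b} → ¬ SumHole b (suc k)
  k+1-not-hole {b} = middle-not-hole ≤-refl (≤-trans (m≤m+n _ 1)
    (≤-trans (≤-reflexive (k+3 k)) (m≤m+n (k + 3) _)))
    where
    k+3 : ∀ k → suc (suc k) + 1 ≡ k + 3
    k+3 = solve-∀

  k+2-not-hole : ∀ {b} → ¬ SumHole b (suc (suc k))
  k+2-not-hole {b} = middle-not-hole (n≤1+n (suc k)) (≤-trans (≤-reflexive (k+3 k)) (m≤m+n (k + 3) _))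
    where
    k+3 : ∀ k → suc (suc (suc k)) ≡ k + 3
    k+3 = solve-∀

  k+3-not-hole-with-W : ¬ SumHole true (suc (suc (suc k)))
  k+3-not-hole-with-W = middle-not-hole (≤-trans (n≤1+n (suc k)) (n≤1+n _)) (≤-reflexive (k+4 k))
    where
    k+4 : ∀ k → suc (suc (suc (suc k))) ≡ k + 3 + 1
    k+4 = solve-∀

  bottom+bottom-not-hole : ∀ {b c₁ c₂} → Pos b c₁ 0 → Pos b c₂ 0 → ¬ SumHole b (c₁ + c₂)
  bottom+bottom-not-hole (inZ _ _ () _) _
  bottom+bottom-not-hole _ (inZ _ _ () _)
  bottom+bottom-not-hole (inX _) (inX _) = small-not-hole z≤n
  bottom+bottom-not-hole (inX _) (inZ₁ _) = small-not-hole (s≤s z≤n)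
  bottom+bottom-not-hole (inX _) (inY _) = k+1-not-hole
  bottom+bottom-not-hole (inX _) (inW _) = k+2-not-hole
  bottom+bottom-not-hole (inZ₁ _) (inX _) = small-not-hole (s≤s z≤n)
  bottom+bottom-not-hole (inZ₁ _) (inZ₁ _) = small-not-hole ≤-refl
  bottom+bottom-not-hole (inZ₁ _) (inY _) = k+2-not-hole
  bottom+bottom-not-hole (inZ₁ _) (inW _) = k+3-not-hole-with-W
  bottom+bottom-not-hole {b} (inY _) (inX _) =
    subst (λ j → ¬ SumHole b j) (sym (+-identityʳ (suc k))) k+1-not-hole
  bottom+bottom-not-hole {b} (inY _) (inZ₁ _) = subst (λ j → ¬ SumHole b j) (+-comm 1 (suc k)) k+2-not-hole
  bottom+bottom-not-hole (inY _) (inY _) = large-not-hole ≤-refl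
  bottom+bottom-not-hole (inY _) (inW _) = large-not-hole (+-monoʳ-≤ (suc k) (n≤1+n (suc k)))
  bottom+bottom-not-hole (inW _) (inX _) =
    subst (λ j → ¬ SumHole true j) (sym (+-identityʳ (suc (suc k)))) k+2-not-hole
  bottom+bottom-not-hole (inW _) (inZ₁ _) =
    subst (λ j → ¬ SumHole true j) (+-comm 1 (suc (suc k))) k+3-not-hole-with-W
  bottom+bottom-not-hole (inW _) (inY _) = large-not-hole (+-monoˡ-≤ (suc k) (n≤1+n (suc k)))
  bottom+bottom-not-hole (inW _) (inW _) = large-not-hole (+-mono-≤ (n≤1+n (suc k)) (n≤1+n (suc k)))

  top+top-not-hole : ∀ {b c₁ c₂} → Pos b c₁ n → Pos b c₂ n → ¬ SumHole b (suc (c₁ + c₂))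
  top+top-not-hole (inZ₁ n<n) _ = ⊥-elim (<-irrefl refl n<n)
  top+top-not-hole (inZ _ _ _ n<n) _ = ⊥-elim (<-irrefl refl n<n)
  top+top-not-hole (inW n<n) _ = ⊥-elim (<-irrefl refl n<n)
  top+top-not-hole _ (inZ₁ n<n) = ⊥-elim (<-irrefl refl n<n)
  top+top-not-hole _ (inZ _ _ _ n<n) = ⊥-elim (<-irrefl refl n<n)
  top+top-not-hole _ (inW n<n) = ⊥-elim (<-irrefl refl n<n)
  top+top-not-hole (inX _) (inX _) = small-not-hole (s≤s z≤n)
  top+top-not-hole (inX _) (inY _) = k+2-not-hole
  top+top-not-hole {b} (inY _) (inX _) =
    subst (λ j → ¬ SumHole b (suc j)) (sym (+-identityʳ (suc k))) k+2-not-hole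
  top+top-not-hole (inY _) (inY _) = large-not-hole (n≤1+n _)

  t+t′≡2n : ∀ {t t′} → t ≤ n → t′ ≤ n → t + t′ ≡ n + n → t ≡ n × t′ ≡ n
  t+t′≡2n {t} {t′} t≤n t′≤n e = t≡n , +-cancelˡ-≡ n t′ n (subst (λ x → x + t′ ≡ n + n) t≡n e)
    where
    t≡n : t ≡ n
    t≡n = ≤-antisym t≤n (+-cancelʳ-≤ n n t (subst (_≤ t + n) e (+-monoʳ-≤ t t′≤n)))

  -- Modulo n, t₁ + t₂ ∈ [0, 2n] must be 0 or 2n (t₁ + t₂ = n would make 2j odd), so t₁ = t₂ ∈ {0, n}.
  sum-not-hole : ∀ {b c₁ t₁ c₂ t₂ j} → Pos b c₁ t₁ → Pos b c₂ t₂ → SumHole b j →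
    pt c₁ t₁ + pt c₂ t₂ ≢ 2 * j * n
  sum-not-hole {b} {c₁} {t₁} {c₂} {t₂} {j} p₁ p₂ hole eq
    with q*n+t≡p*n-cases (2 * (c₁ + c₂)) (2 * j) (+-mono-≤ (Pos⇒t≤n p₁) (Pos⇒t≤n p₂))
        (trans (sym (pt+pt≡pt c₁ t₁ c₂ t₂)) eq)
  ... | inj₁ (t≡0 , e) with m+n≡0⇒m≡0 t₁ t≡0 | m+n≡0⇒n≡0 t₁ t≡0
  ...   | refl | refl = bottom+bottom-not-hole p₁ p₂ (subst (SumHole b) (sym (*-cancelˡ-≡ _ _ 2 e)) hole)
  sum-not-hole {c₁ = c₁} {c₂ = c₂} {j = j} p₁ p₂ hole eq | inj₂ (inj₁ (_ , e)) = even≢odd j (c₁ + c₂) (sym e)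
  sum-not-hole {b} {c₁} {t₁} {c₂} {t₂} {j} p₁ p₂ hole eq | inj₂ (inj₂ (t≡2n , e))
    with t+t′≡2n (Pos⇒t≤n p₁) (Pos⇒t≤n p₂) t≡2n
  ... | refl , refl = top+top-not-hole p₁ p₂ (subst (SumHole b)
      (sym (*-cancelˡ-≡ _ _ 2 (trans (*-suc 2 (c₁ + c₂)) e))) hole)

  top-bottom-not-hole : ∀ {b c c′ i} → Pos b c n → Pos b c′ 0 → DiffHole i → c ≢ c′ + i
  top-bottom-not-hole (inZ₁ n<n) _ _ _ = <-irrefl refl n<n
  top-bottom-not-hole (inZ _ _ _ n<n) _ _ _ = <-irrefl refl n<n
  top-bottom-not-hole (inW n<n) _ _ _ = <-irrefl refl n<n
  top-bottom-not-hole _ (inZ _ _ () _) _ _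
  top-bottom-not-hole (inX _) _ (1≤i , _) e = <⇒≢ (≤-trans 1≤i (m≤n+m _ _)) e
  top-bottom-not-hole (inY _) (inX _) (_ , i<k) e = 1+n≰n (≤-trans (n≤1+n (suc k)) (subst (_< k) (sym e) i<k))
  top-bottom-not-hole (inY _) (inZ₁ _) (_ , i<k) e = 1+n≰n (subst (_≤ k) (sym e) i<k)
  top-bottom-not-hole (inY _) (inY _) (1≤i , _) e = <⇒≢ (m<m+n (suc k) 1≤i) e
  top-bottom-not-hole (inY _) (inW _) _ e = m≢1+m+n (suc k) e

  bottom-top-not-hole : ∀ {b c c′ i} → Pos b c 0 → Pos b c′ n → DiffHole i → c ≢ suc (c′ + i)
  bottom-top-not-hole _ (inZ₁ n<n) _ _ = <-irrefl refl n<n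
  bottom-top-not-hole _ (inZ _ _ _ n<n) _ _ = <-irrefl refl n<n
  bottom-top-not-hole _ (inW n<n) _ _ = <-irrefl refl n<n
  bottom-top-not-hole (inZ _ _ () _) _ _ _
  bottom-top-not-hole (inX _) _ _ ()
  bottom-top-not-hole (inZ₁ _) (inX _) (1≤i , _) e = <⇒≢ 1≤i (suc-injective e)
  bottom-top-not-hole (inY _) (inX _) (_ , i<k) e = 1+n≰n (subst (_< k) (sym (suc-injective e)) i<k)
  bottom-top-not-hole (inW _) (inX _) (_ , i<k) e =
    1+n≰n (≤-trans (subst (_< k) (sym (suc-injective e)) i<k) (n≤1+n k))
  bottom-top-not-hole (inZ₁ _) (inY _) _ ()
  bottom-top-not-hole (inY _) (inY _) _ e = m≢1+m+n (suc k) e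
  bottom-top-not-hole (inW _) (inY _) (s≤s z≤n , _) e = m+1+n≢m k (sym (suc-injective (suc-injective e)))

  -- Modulo n, equal remainders would make 2c odd, so (t, t′) is (n, 0) or (0, n).
  diff-not-hole : ∀ {b c t c′ t′ i} → Pos b c t → Pos b c′ t′ → DiffHole i →
    pt c t ≢ pt c′ t′ + (2 * i + 1) * n
  diff-not-hole {b} {c} {t} {c′} {t′} {i} p p′ hole eq
    with q*n+t≡q′*n+t′-cases (2 * c) (suc (2 * (c′ + i))) (Pos⇒t≤n p) (Pos⇒t≤n p′)
        (trans eq (regroup c′ t′ i n))
    where
    regroup : ∀ c′ t′ i n → 2 * c′ * n + t′ + (2 * i + 1) * n ≡ suc (2 * (c′ + i)) * n + t′
    regroup = solve-∀
  ... | inj₁ (e , _) = even≢odd c (c′ + i) e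
  ... | inj₂ (inj₁ (e , refl , refl)) = top-bottom-not-hole p p′ hole
      (*-cancelˡ-≡ c (c′ + i) 2 (suc-injective e))
  ... | inj₂ (inj₂ (e , refl , refl)) = bottom-top-not-hole p p′ hole
      (*-cancelˡ-≡ c (suc (c′ + i)) 2 (trans e (sym (*-suc 2 (c′ + i)))))

  n′ : ℕ
  n′ = pred n

  n′<n : n′ < n
  n′<n = ≤-reflexive (suc-pred n)

  1≤n′ : 1 ≤ n′
  1≤n′ = pred-mono-≤ 2≤n

  n′+[1+r]≡n+r : ∀ r → n′ + suc r ≡ n + r
  n′+[1+r]≡n+r r = trans (+-suc n′ r) (cong (_+ r) (suc-pred n))

  -- max A = m and max 𝒜 = (2k + 5)n − 1
  top : Bool → ℕ
  top false = pt (suc k) n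
  top true = pt (suc (suc k)) n′

  record IsSum (b : Bool) (s : ℕ) : Set where
    constructor isSum
    field
      {c₁ t₁ c₂ t₂} : ℕ
      pos₁ : Pos b c₁ t₁
      pos₂ : Pos b c₂ t₂
      sum≡ : pt c₁ t₁ + pt c₂ t₂ ≡ s

  isSum-at : ∀ {b c₁ t₁ c₂ t₂} j t → Pos b c₁ t₁ → Pos b c₂ t₂ → c₁ + c₂ ≡ j → t₁ + t₂ ≡ t → IsSum b (pt j t)
  isSum-at {b} {c₁} {t₁} {c₂} {t₂} j t p₁ p₂ refl refl = isSum p₁ p₂ (pt+pt≡pt c₁ t₁ c₂ t₂)

  pt≤pt⇒≤ₗ : ∀ {j t J T} → T < n + n → pt j t ≤ pt J T → (j , t) ≤ₗ (J , T)
  pt≤pt⇒≤ₗ {j} {t} {J} {T} T<2n le with <-cmp j J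
  ... | tri< j<J _ _ = inj₁ j<J
  ... | tri≈ _ refl _ = inj₂ (refl , +-cancelˡ-≤ (2 * j * n) t T le)
  ... | tri> _ _ J<j = ⊥-elim (<-irrefl refl (<-≤-trans (+-monoʳ-< (2 * J * n) T<2n) (≤-trans next-block le)))
    where
    next-block : 2 * J * n + (n + n) ≤ pt j t
    next-block = ≤-trans (≤-reflexive (regroup J n)) (≤-trans (*-monoˡ-≤ n (*-monoʳ-≤ 2 J<j)) (m≤m+n _ t))
      where
      regroup : ∀ J n → 2 * J * n + (n + n) ≡ 2 * suc J * n
      regroup = solve-∀

  past-bound : ∀ {j t J T} → J < j → ¬ ((j , t) ≤ₗ (J , T))
  past-bound J<j (inj₁ j<J) = <-asym J<j j<J
  past-bound J<j (inj₂ (refl , _)) = <-irrefl refl J<j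

  maxSum : Bool → ℕ × ℕ
  maxSum false = suc k + suc k + 1 , 0
  maxSum true = suc k + suc k + 2 , n′ + n′

  2k+3<2k+4 : suc k + suc k + 1 < suc k + suc k + 2
  2k+3<2k+4 = +-monoʳ-< (suc k + suc k) (n<1+n 1)

  maxSum<2k+5 : ∀ b → proj₁ (maxSum b) < suc k + suc k + 3
  maxSum<2k+5 false = <-trans 2k+3<2k+4 (+-monoʳ-< (suc k + suc k) (n<1+n 2))
  maxSum<2k+5 true = +-monoʳ-< (suc k + suc k) (n<1+n 2)

  [k+1]+[k+2]≡2k+3 : suc k + suc (suc k) ≡ suc k + suc k + 1
  [k+1]+[k+2]≡2k+3 = trans (+-suc (suc k) (suc k)) (+-comm 1 (suc k + suc k))

  [k+2]+[k+2]≡2k+4 : suc (suc k) + suc (suc k) ≡ suc k + suc k + 2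
  [k+2]+[k+2]≡2k+4 = trans (cong suc (+-suc (suc k) (suc k))) (+-comm 2 (suc k + suc k))

  sum-bound-cases : ∀ b {j t} → pt j t ≤ top b + top b →
    (j , t) ≤ₗ maxSum b
  sum-bound-cases false le = pt≤pt⇒≤ₗ (+-mono-< 0<n 0<n) (≤-trans le (≤-reflexive (regroup k n)))
    where
    regroup : ∀ k n → 2 * suc k * n + n + (2 * suc k * n + n) ≡ 2 * (suc k + suc k + 1) * n + 0
    regroup = solve-∀
  sum-bound-cases true le = pt≤pt⇒≤ₗ (+-mono-< n′<n n′<n) (≤-trans le (≤-reflexive (regroup k n n′)))
    where
    regroup : ∀ k n n′ →
      2 * suc (suc k) * n + n′ + (2 * suc (suc k) * n + n′) ≡ 2 * (suc k + suc k + 2) * n + (n′ + n′)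
    regroup = solve-∀

  NotSumHole : Bool → ℕ → Set
  NotSumHole b s = ∀ j → SumHole b j → s ≢ 2 * j * n

  k+1+i-hole : ∀ b {i} → 2 + (if b then 1 else 0) ≤ i → i ≤ k → SumHole b (suc k + i)
  k+1+i-hole b {i} lo≤i i≤k =
    inj₂ (≤-trans (≤-reflexive (lower k (if b then 1 else 0))) (+-monoʳ-≤ (suc k) lo≤i) ,
          ≤-trans (+-monoʳ-≤ (suc k) i≤k) (≤-reflexive (upper k)))
    where
    lower : ∀ k x → k + 3 + x ≡ suc k + (2 + x)
    lower = solve-∀
    upper : ∀ k → suc k + k ≡ k + k + 1
    upper = solve-∀

  isSum-2jn+r : ∀ b {j r} → r < n → (j , r) ≤ₗ maxSum b →
    NotSumHole b (pt j r) → IsSum b (pt j r)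
  isSum-2jn+r b {j} = by-index b (blockIndex k j)
    where
    by-index : ∀ b {j r} → BlockIndex k j → r < n → (j , r) ≤ₗ maxSum b →
      NotSumHole b (pt j r) → IsSum b (pt j r)
    by-index _ {r = r} j≡0 r<n _ _ = isSum-at 0 r (inX (<⇒≤ r<n)) (inX z≤n) refl (+-identityʳ r)
    by-index _ {r = r} j≡1 r<n _ _ = isSum-at 1 r (inZ₁ r<n) (inX z≤n) refl (+-identityʳ r)
    by-index _ {j} {zero} (2≤j≤k 2≤j j≤k) _ _ no-hole with m≤n⇒m<n∨m≡n 2≤j
    ... | inj₂ refl = isSum-at 2 0 (inZ₁ 0<n) (inZ₁ 0<n) refl refl
    ... | inj₁ 3≤j = ⊥-elim (no-hole j (inj₁ (3≤j , j≤k)) (+-identityʳ _))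
    by-index _ {j} {suc r} (2≤j≤k 2≤j j≤k) r<n _ _ =
      isSum-at j (suc r) (inZ 2≤j j≤k (s≤s z≤n) r<n) (inX z≤n) (+-identityʳ j) (+-identityʳ _)
    by-index _ {r = r} j≡k+1 r<n _ _ = isSum-at (suc k) r (inY (<⇒≤ r<n)) (inX z≤n) (+-identityʳ _)
      (+-identityʳ r)
    by-index _ {r = r} j≡k+2 r<n _ _ = isSum-at (suc (suc k)) r (inY z≤n) (inZ₁ r<n) (+-comm (suc k) 1) refl
    by-index false {r = zero} (k+1+[2,k] 2≤i i≤k) _ _ no-hole =
      ⊥-elim (no-hole _ (k+1+i-hole false 2≤i i≤k) (+-identityʳ _))
    by-index true {r = zero} (k+1+[2,k] 2≤i i≤k) _ _ no-hole with m≤n⇒m<n∨m≡n 2≤i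
    ... | inj₁ 3≤i = ⊥-elim (no-hole _ (k+1+i-hole true 3≤i i≤k) (+-identityʳ _))
    ... | inj₂ refl = isSum-at (suc k + 2) 0 (inZ₁ 0<n) (inW 0<n) (cong suc (+-comm 2 k)) refl
    by-index _ {r = suc r} (k+1+[2,k] {i} 2≤i i≤k) r<n _ _ =
      isSum-at (suc k + i) (suc r) (inY z≤n) (inZ 2≤i i≤k (s≤s z≤n) r<n) refl refl
    by-index _ {r = r} j≡2k+2 r<n _ _ = isSum-at (suc k + suc k) r (inY (<⇒≤ r<n)) (inY z≤n) refl
      (+-identityʳ r)
    by-index false j≡2k+3 _ (inj₁ 2k+3<2k+3) _ = ⊥-elim (<-irrefl refl 2k+3<2k+3)
    by-index false j≡2k+3 _ (inj₂ (_ , z≤n)) _ = isSum (inY ≤-refl) (inY ≤-refl) (regroup k n)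
      where
      regroup : ∀ k n → 2 * suc k * n + n + (2 * suc k * n + n) ≡ 2 * (suc k + suc k + 1) * n + 0
      regroup = solve-∀
    by-index true {r = r} j≡2k+3 r<n _ _ =
      isSum-at _ r (inY (<⇒≤ r<n)) (inW 0<n) [k+1]+[k+2]≡2k+3 (+-identityʳ r)
    by-index false j≡2k+4 _ bound _ = ⊥-elim (past-bound 2k+3<2k+4 bound)
    by-index true {r = r} j≡2k+4 r<n _ _ = isSum-at _ r (inW r<n) (inW 0<n) [k+2]+[k+2]≡2k+4 (+-identityʳ r)
    by-index b (j≥2k+5 d) _ bound _ = ⊥-elim (past-bound (≤-trans (maxSum<2k+5 b) (m≤m+n _ d)) bound)

  isSum-2jn+n+r : ∀ b {j r} → r < n → (j , n + r) ≤ₗ maxSum b →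
    IsSum b (pt j (n + r))
  isSum-2jn+n+r b {j} = by-index b (blockIndex k j)
    where
    by-index : ∀ b {j r} → BlockIndex k j → r < n → (j , n + r) ≤ₗ maxSum b →
      IsSum b (pt j (n + r))
    by-index _ {r = r} j≡0 r<n _ = isSum-at 0 (n + r) (inX ≤-refl) (inX (<⇒≤ r<n)) refl refl
    by-index _ {r = r} j≡1 r<n _ = isSum-at 1 (n + r) (inZ₁ r<n) (inX ≤-refl) refl (+-comm r n)
    by-index _ {j} {r} (2≤j≤k 2≤j j≤k) r<n _ =
      isSum-at j (n + r) (inZ 2≤j j≤k 1≤n′ n′<n) (inX r<n) (+-identityʳ j) (n′+[1+r]≡n+r r)
    by-index _ {r = r} j≡k+1 r<n _ = isSum-at (suc k) (n + r) (inY ≤-refl) (inX (<⇒≤ r<n))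
      (+-identityʳ _) refl
    by-index _ {r = r} j≡k+2 r<n _ = isSum-at (suc (suc k)) (n + r) (inY ≤-refl) (inZ₁ r<n)
      (+-comm (suc k) 1) refl
    by-index _ {r = r} (k+1+[2,k] {i} 2≤i i≤k) r<n _ =
      isSum-at (suc k + i) (n + r) (inY r<n) (inZ 2≤i i≤k 1≤n′ n′<n) refl
        (trans (+-comm (suc r) n′) (n′+[1+r]≡n+r r))
    by-index _ {r = r} j≡2k+2 r<n _ = isSum-at (suc k + suc k) (n + r) (inY ≤-refl) (inY (<⇒≤ r<n)) refl refl
    by-index false j≡2k+3 _ (inj₁ 2k+3<2k+3) = ⊥-elim (<-irrefl refl 2k+3<2k+3)
    by-index false j≡2k+3 _ (inj₂ (_ , n+r≤0)) =
      ⊥-elim (<-irrefl refl (<-≤-trans 0<n (≤-trans (m≤m+n n _) n+r≤0)))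
    by-index true {r = r} j≡2k+3 r<n _ = isSum-at _ (n + r) (inY ≤-refl) (inW r<n) [k+1]+[k+2]≡2k+3 refl
    by-index false j≡2k+4 _ bound = ⊥-elim (past-bound 2k+3<2k+4 bound)
    by-index true j≡2k+4 _ (inj₁ 2k+4<2k+4) = ⊥-elim (<-irrefl refl 2k+4<2k+4)
    by-index true {r = r} j≡2k+4 _ (inj₂ (_ , n+r≤2n′)) =
      isSum-at _ (n + r) (inW n′<n) (inW 1+r<n) [k+2]+[k+2]≡2k+4 (n′+[1+r]≡n+r r)
      where
      1+r<n : suc r < n
      1+r<n = ≤-trans (s≤s (+-cancelˡ-≤ n′ (suc r) n′ (subst (_≤ n′ + n′) (sym (n′+[1+r]≡n+r r)) n+r≤2n′)))
        (≤-reflexive (suc-pred n))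
    by-index b (j≥2k+5 d) _ bound = ⊥-elim (past-bound (≤-trans (maxSum<2k+5 b) (m≤m+n _ d)) bound)

  non-hole⇒IsSum : ∀ b {s} → s ≤ top b + top b → NotSumHole b s → IsSum b s
  non-hole⇒IsSum b {s} s≤ no-hole with 2jn+r⊎2jn+n+r n s
  ... | j , r , r<n , inj₁ refl = isSum-2jn+r b {j} r<n (sum-bound-cases b {j} s≤) no-hole
  ... | j , r , r<n , inj₂ refl = isSum-2jn+n+r b {j} r<n (sum-bound-cases b {j} s≤)

  topA≤top𝒜 : top false ≤ top true
  topA≤top𝒜 = ≤-trans (+-monoʳ-≤ (2 * suc k * n) (m≤m+n n (n + n′))) (≤-reflexive (regroup k n n′))
    where
    regroup : ∀ k n n′ → 2 * suc k * n + (n + (n + n′)) ≡ 2 * suc (suc k) * n + n′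
    regroup = solve-∀

  Pos⇒≤top : ∀ {b c t} → Pos b c t → pt c t ≤ top b
  Pos⇒≤top {false} p = +-mono-≤ (*-monoˡ-≤ n (*-monoʳ-≤ 2 (c≤k+1 p))) (Pos⇒t≤n p)
    where
    c≤k+1 : ∀ {c t} → Pos false c t → c ≤ suc k
    c≤k+1 (inX _) = z≤n
    c≤k+1 (inZ₁ _) = s≤s z≤n
    c≤k+1 (inZ _ j≤k _ _) = ≤-trans j≤k (n≤1+n k)
    c≤k+1 (inY _) = ≤-refl
  Pos⇒≤top {true} (inW t<n) = +-monoʳ-≤ (2 * suc (suc k) * n)
    (≤-pred (≤-trans t<n (≤-reflexive (sym (suc-pred n)))))
  Pos⇒≤top {true} (inX p) = ≤-trans (Pos⇒≤top (inX {false} p)) topA≤top𝒜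
  Pos⇒≤top {true} (inZ₁ p) = ≤-trans (Pos⇒≤top (inZ₁ {false} p)) topA≤top𝒜
  Pos⇒≤top {true} (inZ p q r s) = ≤-trans (Pos⇒≤top (inZ {false} p q r s)) topA≤top𝒜
  Pos⇒≤top {true} (inY p) = ≤-trans (Pos⇒≤top (inY {false} p)) topA≤top𝒜

  IsSum⇒≤ : ∀ {b s} → IsSum b s → s ≤ top b + top b
  IsSum⇒≤ (isSum p₁ p₂ refl) = +-mono-≤ (Pos⇒≤top p₁) (Pos⇒≤top p₂)

  IsSum⇒NotSumHole : ∀ {b s} → IsSum b s → NotSumHole b s
  IsSum⇒NotSumHole (isSum p₁ p₂ refl) j hole = sum-not-hole p₁ p₂ hole

  record IsDiff (b : Bool) (d : ℕ) : Set where
    constructor isDiff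
    field
      {c t c′ t′} : ℕ
      pos : Pos b c t
      pos′ : Pos b c′ t′
      diff≡ : pt c t ≡ pt c′ t′ + d

  NotDiffHole : ℕ → Set
  NotDiffHole d = ∀ i → DiffHole i → d ≢ (2 * i + 1) * n

  maxDiff : Bool → ℕ × ℕ
  maxDiff false = suc k , n
  maxDiff true = suc (suc k) , n′

  diff-bound-cases : ∀ b {j t} → pt j t ≤ top b → (j , t) ≤ₗ maxDiff b
  diff-bound-cases false = pt≤pt⇒≤ₗ (m<m+n n 0<n)
  diff-bound-cases true = pt≤pt⇒≤ₗ (<-≤-trans n′<n (m≤m+n n n))

  k+2<k+1+i : ∀ {i} → 2 ≤ i → suc (suc k) < suc k + i
  k+2<k+1+i 2≤i = ≤-trans (≤-reflexive (cong suc (+-comm 2 k))) (+-monoʳ-≤ (suc k) 2≤i)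

  k+2<2k+2 : suc (suc k) < suc k + suc k
  k+2<2k+2 = k+2<k+1+i (s≤s (≤-trans (s≤s z≤n) 2≤k))

  k+2<2k+2+x : ∀ x → suc (suc k) < suc k + suc k + x
  k+2<2k+2+x x = ≤-trans k+2<2k+2 (m≤m+n _ x)

  past-maxDiff : ∀ b {j t} → suc (suc k) < j → ¬ ((j , t) ≤ₗ maxDiff b)
  past-maxDiff false k+2<j = past-bound (<-trans (n<1+n (suc k)) k+2<j)
  past-maxDiff true k+2<j = past-bound k+2<j

  [2j+2]n+r : ∀ j n r → 2 * suc j * n + r ≡ n + (2 * j * n + (n + r))
  [2j+2]n+r = solve-∀

  isDiff-2jn+r : ∀ b {j r} → r < n → (j , r) ≤ₗ maxDiff b → IsDiff b (pt j r)
  isDiff-2jn+r b {j} = by-index b (blockIndex k j)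
    where
    by-index : ∀ b {j r} → BlockIndex k j → r < n → (j , r) ≤ₗ maxDiff b →
      IsDiff b (pt j r)
    by-index _ j≡0 r<n _ = isDiff (inX (<⇒≤ r<n)) (inX z≤n) refl
    by-index _ j≡1 r<n _ = isDiff (inZ₁ r<n) (inX z≤n) refl
    by-index _ {j} {zero} (2≤j≤k 2≤j j≤k) _ _ = isDiff (inZ 2≤j j≤k ≤-refl 2≤n) (inX 0<n) (shift j n)
      where
      shift : ∀ j n → 2 * j * n + 1 ≡ 1 + (2 * j * n + 0)
      shift = solve-∀
    by-index _ {r = suc r} (2≤j≤k 2≤j j≤k) r<n _ = isDiff (inZ 2≤j j≤k (s≤s z≤n) r<n) (inX z≤n) refl
    by-index _ j≡k+1 r<n _ = isDiff (inY (<⇒≤ r<n)) (inX z≤n) refl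
    by-index false j≡k+2 _ bound = ⊥-elim (past-bound (n<1+n (suc k)) bound)
    by-index true j≡k+2 r<n _ = isDiff (inW r<n) (inX z≤n) refl
    by-index b (k+1+[2,k] 2≤i _) _ bound = ⊥-elim (past-maxDiff b (k+2<k+1+i 2≤i) bound)
    by-index b j≡2k+2 _ bound = ⊥-elim (past-maxDiff b k+2<2k+2 bound)
    by-index b j≡2k+3 _ bound = ⊥-elim (past-maxDiff b (k+2<2k+2+x 1) bound)
    by-index b j≡2k+4 _ bound = ⊥-elim (past-maxDiff b (k+2<2k+2+x 2) bound)
    by-index b (j≥2k+5 d) _ bound = ⊥-elim (past-maxDiff b (≤-trans (k+2<2k+2+x 3) (m≤m+n _ d)) bound)

  [2j+1]n≡2jn+n : ∀ j → (2 * j + 1) * n ≡ 2 * j * n + n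
  [2j+1]n≡2jn+n j = regroup j n
    where
    regroup : ∀ j n → (2 * j + 1) * n ≡ 2 * j * n + n
    regroup = solve-∀

  2jn+[n+0]≡[2j+1]n : ∀ j → 2 * j * n + (n + 0) ≡ (2 * j + 1) * n
  2jn+[n+0]≡[2j+1]n j = trans (cong (_+_ (2 * j * n)) (+-identityʳ n)) (sym ([2j+1]n≡2jn+n j))

  isDiff-2jn+n+r : ∀ b {j r} → r < n → (j , n + r) ≤ₗ maxDiff b →
    NotDiffHole (pt j (n + r)) → IsDiff b (pt j (n + r))
  isDiff-2jn+n+r b {j} = by-index b (blockIndex k j)
    where
    by-index : ∀ b {j r} → BlockIndex k j → r < n → (j , n + r) ≤ₗ maxDiff b →
      NotDiffHole (pt j (n + r)) → IsDiff b (pt j (n + r))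
    by-index _ {r = zero} j≡0 _ _ _ = isDiff (inX ≤-refl) (inX z≤n) (sym (+-identityʳ n))
    by-index _ {r = suc r} j≡0 r<n _ _ = isDiff (inZ₁ (<-trans (n<1+n r) r<n)) (inX (<⇒≤ n′<n)) eq
      where
      open ≡-Reasoning
      eq : 2 * 1 * n + r ≡ n′ + (n + suc r)
      eq = begin
        2 * 1 * n + r       ≡⟨ [2j+2]n+r 0 n r ⟩
        n + (n + r)         ≡⟨ cong (_+_ n) (n′+[1+r]≡n+r r) ⟨
        n + (n′ + suc r)    ≡⟨ +-comm n _ ⟩
        n′ + suc r + n      ≡⟨ +-assoc n′ (suc r) n ⟩
        n′ + (suc r + n)    ≡⟨ cong (_+_ n′) (+-comm (suc r) n) ⟩
        n′ + (n + suc r)    ∎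
    by-index _ {r = zero} j≡1 _ _ no-hole = ⊥-elim (no-hole 1 (≤-refl , 2≤k) (2jn+[n+0]≡[2j+1]n 1))
    by-index _ {r = suc r} j≡1 r<n _ _ =
      isDiff (inZ ≤-refl 2≤k (s≤s z≤n) r<n) (inX ≤-refl) ([2j+2]n+r 1 n (suc r))
    by-index b {j} {r} (2≤j≤k 2≤j j≤k) r<n _ no-hole with m≤n⇒m<n∨m≡n j≤k
    ... | inj₂ refl = isDiff (inY (<⇒≤ r<n)) (inX ≤-refl) ([2j+2]n+r k n r)
    ... | inj₁ j<k = below-k r r<n no-hole
      where
      below-k : ∀ r → r < n → NotDiffHole (pt j (n + r)) → IsDiff b (pt j (n + r))
      below-k zero _ no-hole = ⊥-elim (no-hole j (≤-trans (s≤s z≤n) 2≤j , j<k) (2jn+[n+0]≡[2j+1]n j))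
      below-k (suc r) r<n _ = isDiff (inZ (≤-trans 2≤j (n≤1+n j)) j<k (s≤s z≤n) r<n) (inX ≤-refl)
        ([2j+2]n+r j n (suc r))
    by-index false {r = zero} j≡k+1 _ _ _ =
      isDiff (inY ≤-refl) (inX z≤n) (cong (_+_ (2 * suc k * n)) (sym (+-identityʳ n)))
    by-index false {r = suc r} j≡k+1 _ (inj₁ k+1<k+1) _ = ⊥-elim (<-irrefl refl k+1<k+1)
    by-index false {r = suc r} j≡k+1 _ (inj₂ (_ , n+1+r≤n)) _ = ⊥-elim (m+1+n≰m n n+1+r≤n)
    by-index true {r = r} j≡k+1 r<n _ _ = isDiff (inW r<n) (inX ≤-refl) ([2j+2]n+r (suc k) n r)
    by-index false j≡k+2 _ bound _ = ⊥-elim (past-bound (n<1+n (suc k)) bound)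
    by-index true j≡k+2 _ (inj₁ k+2<k+2) _ = ⊥-elim (<-irrefl refl k+2<k+2)
    by-index true j≡k+2 _ (inj₂ (_ , n+r≤n′)) _ = ⊥-elim (<⇒≱ n′<n (≤-trans (m≤m+n n _) n+r≤n′))
    by-index b (k+1+[2,k] 2≤i _) _ bound _ = ⊥-elim (past-maxDiff b (k+2<k+1+i 2≤i) bound)
    by-index b j≡2k+2 _ bound _ = ⊥-elim (past-maxDiff b k+2<2k+2 bound)
    by-index b j≡2k+3 _ bound _ = ⊥-elim (past-maxDiff b (k+2<2k+2+x 1) bound)
    by-index b j≡2k+4 _ bound _ = ⊥-elim (past-maxDiff b (k+2<2k+2+x 2) bound)
    by-index b (j≥2k+5 d) _ bound _ = ⊥-elim (past-maxDiff b (≤-trans (k+2<2k+2+x 3) (m≤m+n _ d)) bound)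

  non-hole⇒IsDiff : ∀ b {d} → d ≤ top b → NotDiffHole d → IsDiff b d
  non-hole⇒IsDiff b {d} d≤ no-hole with 2jn+r⊎2jn+n+r n d
  ... | j , r , r<n , inj₁ refl = isDiff-2jn+r b {j} r<n (diff-bound-cases b {j} d≤)
  ... | j , r , r<n , inj₂ refl = isDiff-2jn+n+r b {j} r<n (diff-bound-cases b {j} d≤) no-hole

  IsDiff⇒≤ : ∀ {b d} → IsDiff b d → d ≤ top b
  IsDiff⇒≤ {d = d} (isDiff {c′ = c′} {t′} p _ eq) =
    ≤-trans (subst (d ≤_) (sym eq) (m≤n+m d (pt c′ t′))) (Pos⇒≤top p)

  IsDiff⇒NotDiffHole : ∀ {b d} → IsDiff b d → NotDiffHole d
  IsDiff⇒NotDiffHole {d = d} (isDiff {c′ = c′} {t′} p p′ eq) i hole d≡ =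
    diff-not-hole p p′ hole (trans eq (cong (_+_ (pt c′ t′)) d≡))

  ∈-window⁻ : ∀ c {lo hi z} → 0 < hi → z ∈ interval (pt c lo) (pt c hi ∸ 1) →
    ∃[ t ] (lo ≤ t × t < hi × z ≡ + pt c t)
  ∈-window⁻ c {lo} {hi} 0<hi z∈ with ∈-interval⁻ z∈
  ... | x , lo≤x , x≤ , refl = x ∸ base , lo≤t , t<hi , cong +_ (sym x≡)
    where
    base = 2 * c * n
    x≡ : base + (x ∸ base) ≡ x
    x≡ = m+[n∸m]≡n (≤-trans (m≤m+n base lo) lo≤x)
    lo≤t : lo ≤ x ∸ base
    lo≤t = +-cancelˡ-≤ base lo _ (subst (base + lo ≤_) (sym x≡) lo≤x)
    t<hi : x ∸ base < hi
    t<hi = +-cancelˡ-< base _ hi (subst (_< base + hi) (sym x≡) (≤∸1⇒< (<-≤-trans 0<hi (m≤n+m hi base)) x≤))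

  ∈-window⁺ : ∀ c {lo hi t} → lo ≤ t → t < hi → + pt c t ∈ interval (pt c lo) (pt c hi ∸ 1)
  ∈-window⁺ c lo≤t t<hi = ∈-interval⁺ (+-monoʳ-≤ (2 * c * n) lo≤t) (<⇒≤∸1 (+-monoʳ-< (2 * c * n) t<hi))

  Zpart≡window : ∀ j → C.Zpart j ≡ interval (pt j 1) (pt j n ∸ 1)
  Zpart≡window j = cong (λ e → interval (pt j 1) (e ∸ 1)) ([2j+1]n≡2jn+n j)

  W≡window : C.W ≡ interval (pt (suc (suc k)) 0) (pt (suc (suc k)) n ∸ 1)
  W≡window = cong₂ (λ a e → interval a (e ∸ 1)) (lower k n) (upper k n)
    where
    lower : ∀ k n → (2 * k + 4) * n ≡ 2 * suc (suc k) * n + 0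
    lower = solve-∀
    upper : ∀ k n → (2 * k + 5) * n ≡ 2 * suc (suc k) * n + n
    upper = solve-∀

  m-x≡ : ∀ {x} → x ≤ n → + C.m ℤ.- + x ≡ + pt (suc k) (n ∸ x)
  m-x≡ {x} x≤n = begin
    + C.m ℤ.- + x                ≡⟨ cong (λ m → + m ℤ.- + x) m≡ ⟩
    + pt (suc k) n ℤ.- + x       ≡⟨ ℤ.[+m]-[+n]≡m⊖n (pt (suc k) n) x ⟩
    pt (suc k) n ℤ.⊖ x           ≡⟨ ℤ.⊖-≥ (≤-trans x≤n (m≤n+m n _)) ⟩
    + (pt (suc k) n ∸ x)         ≡⟨ cong +_ (+-∸-assoc (2 * suc k * n) x≤n) ⟩
    + pt (suc k) (n ∸ x)         ∎
    where
    open ≡-Reasoning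
    m≡ : C.m ≡ pt (suc k) n
    m≡ = regroup k n
      where
      regroup : ∀ k n → (2 * k + 3) * n ≡ 2 * suc k * n + n
      regroup = solve-∀

  ∈-Y⁻ : ∀ {z} → z ∈ C.Y → ∃[ t ] (t ≤ n × z ≡ + pt (suc k) t)
  ∈-Y⁻ z∈ with ∈-map⁻ (λ x → + C.m ℤ.- x) z∈
  ... | _ , x∈ , refl with ∈-interval⁻ {0} {n} x∈
  ...   | x , _ , x≤n , refl = n ∸ x , m∸n≤m n x , m-x≡ x≤n

  ∈-Y⁺ : ∀ {t} → t ≤ n → + pt (suc k) t ∈ C.Y
  ∈-Y⁺ {t} t≤n = subst (_∈ C.Y) (trans (m-x≡ (m∸n≤m n t)) (cong (λ t → + pt (suc k) t) (m∸[m∸n]≡n t≤n)))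
    (∈-map⁺ (λ x → + C.m ℤ.- x) (∈-interval⁺ {0} {n} z≤n (m∸n≤m n t)))

  ∈-Z⁺ : ∀ {j t} → 1 ≤ j → j ≤ k → 1 ≤ t → t < n → + pt j t ∈ C.Z
  ∈-Z⁺ {suc j₀} {t} _ j≤k 1≤t t<n = ∈-concatMap⁺ C.Zpart (lose (∈-map⁺ suc (∈-upTo⁺ j≤k))
    (subst (+ pt (suc j₀) t ∈_) (sym (Zpart≡window (suc j₀))) (∈-window⁺ (suc j₀) {1} {n} 1≤t t<n)))

  ∈-A⁻ : ∀ {z} → z ∈ C.A → ∃[ c ] ∃[ t ] (Pos false c t × z ≡ + pt c t)
  ∈-A⁻ z∈ with ∈-++⁻ C.B z∈
  ... | inj₂ (here refl) = 1 , 0 , inZ₁ 0<n , cong +_ (sym (+-identityʳ (2 * n)))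
  ... | inj₁ z∈B with ∈-++⁻ C.X z∈B
  ...   | inj₁ z∈X with ∈-interval⁻ {0} {n} z∈X
  ...     | t , _ , t≤n , z≡ = 0 , t , inX t≤n , z≡
  ∈-A⁻ z∈ | inj₁ z∈B | inj₂ z∈YZ with ∈-++⁻ C.Y z∈YZ
  ...   | inj₁ z∈Y with ∈-Y⁻ z∈Y
  ...     | t , t≤n , z≡ = suc k , t , inY t≤n , z≡
  ∈-A⁻ z∈ | inj₁ z∈B | inj₂ z∈YZ | inj₂ z∈Z with find (∈-concatMap⁻ C.Zpart {xs = map suc (upTo k)} z∈Z)
  ...   | j , j∈ , z∈Zj with ∈-map⁻ suc {xs =
      upTo k} j∈ | ∈-window⁻ j {1} {n} 0<n (subst (_ ∈_) (Zpart≡window j) z∈Zj)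
  ...     | zero , _ , refl | t , _ , t<n , z≡ = 1 , t , inZ₁ t<n , z≡
  ...     | suc j₀ , j₀∈ , refl | t , 1≤t , t<n , z≡ =
      suc (suc j₀) , t , inZ (s≤s (s≤s z≤n)) (∈-upTo⁻ j₀∈) 1≤t t<n , z≡

  ∈-A⁺ : ∀ {c t} → Pos false c t → + pt c t ∈ C.A
  ∈-A⁺ (inX t≤n) = ∈-++⁺ˡ (∈-++⁺ˡ (∈-interval⁺ {0} {n} z≤n t≤n))
  ∈-A⁺ (inZ₁ {t = zero} _) = ∈-++⁺ʳ C.B (here (cong +_ (+-identityʳ (2 * n))))
  ∈-A⁺ (inZ₁ {t = suc t} t<n) = ∈-++⁺ˡ (∈-++⁺ʳ C.X
    (∈-++⁺ʳ C.Y (∈-Z⁺ ≤-refl (≤-trans (s≤s z≤n) 2≤k) (s≤s z≤n) t<n)))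
  ∈-A⁺ (inZ 2≤j j≤k 1≤t t<n) = ∈-++⁺ˡ (∈-++⁺ʳ C.X (∈-++⁺ʳ C.Y (∈-Z⁺ (≤-trans (s≤s z≤n) 2≤j) j≤k 1≤t t<n)))
  ∈-A⁺ (inY t≤n) = ∈-++⁺ˡ (∈-++⁺ʳ C.X (∈-++⁺ˡ (∈-Y⁺ t≤n)))

  ∈-𝒜⁻ : ∀ {z} → z ∈ C.𝒜 → ∃[ c ] ∃[ t ] (Pos true c t × z ≡ + pt c t)
  ∈-𝒜⁻ {z} z∈ with ∈-++⁻ C.A z∈
  ... | inj₁ z∈A with ∈-A⁻ z∈A
  ...   | c , t , p , z≡ = c , t , Pos-A⊆𝒜 p , z≡
  ∈-𝒜⁻ {z} z∈ | inj₂ z∈W =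
    let t , _ , t<n , z≡ = ∈-window⁻ (suc (suc k)) {0} {n} 0<n (subst (z ∈_) W≡window z∈W)
    in suc (suc k) , t , inW t<n , z≡

  ∈-𝒜⁺ : ∀ {c t} → Pos true c t → + pt c t ∈ C.𝒜
  ∈-𝒜⁺ (inX p) = ∈-++⁺ˡ (∈-A⁺ (inX p))
  ∈-𝒜⁺ (inZ₁ p) = ∈-++⁺ˡ (∈-A⁺ (inZ₁ p))
  ∈-𝒜⁺ (inZ p q r s) = ∈-++⁺ˡ (∈-A⁺ (inZ p q r s))
  ∈-𝒜⁺ (inY p) = ∈-++⁺ˡ (∈-A⁺ (inY p))
  ∈-𝒜⁺ (inW {t} p) = ∈-++⁺ʳ C.A (subst (+ pt (suc (suc k)) t ∈_) (sym W≡window)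
    (∈-window⁺ (suc (suc k)) {0} {n} z≤n p))

  set : Bool → List ℤ
  set false = C.A
  set true = C.𝒜

  ∈-set⁻ : ∀ b {z} → z ∈ set b → ∃[ c ] ∃[ t ] (Pos b c t × z ≡ + pt c t)
  ∈-set⁻ false = ∈-A⁻
  ∈-set⁻ true = ∈-𝒜⁻

  ∈-set⁺ : ∀ b {c t} → Pos b c t → + pt c t ∈ set b
  ∈-set⁺ false = ∈-A⁺
  ∈-set⁺ true = ∈-𝒜⁺

  ∈-sumset⇒IsSum : ∀ b {z} → z ∈ sumset (set b) → ∃[ s ] (z ≡ + s × IsSum b s)
  ∈-sumset⇒IsSum b z∈ with ∈-sumset⁻ z∈
  ... | _ , _ , x∈ , y∈ , refl with ∈-set⁻ b x∈ | ∈-set⁻ b y∈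
  ...   | c₁ , t₁ , p₁ , refl | c₂ , t₂ , p₂ , refl = pt c₁ t₁ + pt c₂ t₂ , refl , isSum p₁ p₂ refl

  IsSum⇒∈-sumset : ∀ b {s} → IsSum b s → + s ∈ sumset (set b)
  IsSum⇒∈-sumset b (isSum p₁ p₂ refl) = ∈-sumset⁺ (∈-set⁺ b p₁) (∈-set⁺ b p₂)

  ∈-diffset⇒IsDiff : ∀ b {z} → z ∈ diffset (set b) → IsDiff b ∣ z ∣
  ∈-diffset⇒IsDiff b z∈ with ∈-diffset⁻ z∈
  ... | _ , _ , x∈ , y∈ , refl with ∈-set⁻ b x∈ | ∈-set⁻ b y∈
  ...   | c , t , p , refl | c′ , t′ , p′ , refl with pt c′ t′ ≤? pt c t
  ...     | yes y≤x = subst (IsDiff b) (sym (cong ∣_∣ ([+x]-[+y]≡+d x≡y+d))) (isDiff p p′ x≡y+d)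
    where
    x≡y+d = sym (m+[n∸m]≡n y≤x)
  ...     | no y≰x = subst (IsDiff b) (sym (trans (cong ∣_∣ ([+y]-[+x]≡-d y≡x+d)) (ℤ.∣-i∣≡∣i∣ (+ _))))
      (isDiff p′ p y≡x+d)
    where
    y≡x+d = sym (m+[n∸m]≡n (<⇒≤ (≰⇒> y≰x)))

  IsDiff⇒∈-diffset : ∀ b {z} → IsDiff b ∣ z ∣ → z ∈ diffset (set b)
  IsDiff⇒∈-diffset b {z} (isDiff p p′ eq) with ±∣z∣ z
  ... | inj₁ z≡ = subst (_∈ diffset (set b)) (trans ([+x]-[+y]≡+d eq) (sym z≡))
      (∈-diffset⁺ (∈-set⁺ b p) (∈-set⁺ b p′))
  ... | inj₂ z≡ = subst (_∈ diffset (set b)) (trans ([+y]-[+x]≡-d eq) (sym z≡))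
      (∈-diffset⁺ (∈-set⁺ b p′) (∈-set⁺ b p))

  k₀ : ℕ
  k₀ = k ∸ 2

  2+k₀≡k : 2 + k₀ ≡ k
  2+k₀≡k = m+[n∸m]≡n 2≤k

  sumHoleIndices : Bool → List ℕ
  sumHoleIndices b = range 3 k₀ ++ range (k + 3 + (if b then 1 else 0)) (if b then k₀ else suc k₀)

  second-range-end : ∀ b → k + 3 + (if b then 1 else 0) + (if b then k₀ else suc k₀) ≡ suc (k + k + 1)
  second-range-end false = subst (λ K → K + 3 + 0 + suc k₀ ≡ suc (K + K + 1)) 2+k₀≡k (regroup k₀)
    where
    regroup : ∀ k₀ → 2 + k₀ + 3 + 0 + suc k₀ ≡ suc (2 + k₀ + (2 + k₀) + 1)
    regroup = solve-∀
  second-range-end true = subst (λ K → K + 3 + 1 + k₀ ≡ suc (K + K + 1)) 2+k₀≡k (regroup k₀)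
    where
    regroup : ∀ k₀ → 2 + k₀ + 3 + 1 + k₀ ≡ suc (2 + k₀ + (2 + k₀) + 1)
    regroup = solve-∀

  ∈-sumHoleIndices⁻ : ∀ b {j} → j ∈ sumHoleIndices b → SumHole b j
  ∈-sumHoleIndices⁻ b {j} j∈ with ∈-++⁻ (range 3 k₀) j∈
  ... | inj₁ j∈₁ with ∈-range⁻ j∈₁
  ...   | 3≤j , j<3+k₀ = inj₁ (3≤j , s≤s⁻¹ (subst (j <_) (cong suc 2+k₀≡k) j<3+k₀))
  ∈-sumHoleIndices⁻ b {j} j∈ | inj₂ j∈₂ with ∈-range⁻ j∈₂
  ...   | lo≤j , j<end = inj₂ (lo≤j , s≤s⁻¹ (subst (j <_) (second-range-end b) j<end))

  ∈-sumHoleIndices⁺ : ∀ b {j} → SumHole b j → j ∈ sumHoleIndices b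
  ∈-sumHoleIndices⁺ b {j} (inj₁ (3≤j , j≤k)) =
    ∈-++⁺ˡ (∈-range⁺ 3≤j (subst (j <_) (sym (cong suc 2+k₀≡k)) (s≤s j≤k)))
  ∈-sumHoleIndices⁺ b {j} (inj₂ (lo≤j , j≤2k+1)) =
    ∈-++⁺ʳ (range 3 k₀) (∈-range⁺ lo≤j (subst (j <_) (sym (second-range-end b)) (s≤s j≤2k+1)))

  sumHoleIndices-unique : ∀ b → Unique (sumHoleIndices b)
  sumHoleIndices-unique b = ++⁺ (range-unique 3 k₀) (range-unique _ _) apart
    where
    3+k₀≤lo : 3 + k₀ ≤ k + 3 + (if b then 1 else 0)
    3+k₀≤lo = ≤-trans (≤-reflexive (trans (cong suc 2+k₀≡k) (+-comm 1 k)))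
      (≤-trans (+-monoʳ-≤ k (s≤s z≤n)) (m≤m+n (k + 3) _))
    apart : ∀ {j} → ¬ (j ∈ range 3 k₀ × j ∈ range (k + 3 + (if b then 1 else 0)) (if b then k₀ else suc k₀))
    apart (j∈₁ , j∈₂) = <⇒≱ (proj₂ (∈-range⁻ j∈₁)) (≤-trans 3+k₀≤lo (proj₁ (∈-range⁻ j∈₂)))

  sumHoles : Bool → List ℤ
  sumHoles b = map (λ j → + (2 * j * n)) (sumHoleIndices b)

  diffHoles : List ℤ
  diffHoles = signed (map (λ i → (2 * i + 1) * n) (range 1 (suc k₀)))

  ∈-diffHoleIndices⇔ : ∀ {i} → (i ∈ range 1 (suc k₀) → DiffHole i) × (DiffHole i → i ∈ range 1 (suc k₀))
  ∈-diffHoleIndices⇔ {i} =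
    (λ i∈ → proj₁ (∈-range⁻ i∈) , subst (i <_) 2+k₀≡k (proj₂ (∈-range⁻ i∈))) ,
    (λ (1≤i , i<k) → ∈-range⁺ 1≤i (subst (i <_) (sym 2+k₀≡k) i<k))

  2jn-injective : ∀ {j j′} → + (2 * j * n) ≡ + (2 * j′ * n) → j ≡ j′
  2jn-injective {j} {j′} eq = *-cancelˡ-≡ j j′ 2 (*-cancelʳ-≡ (2 * j) (2 * j′) n (ℤ.+-injective eq))

  [2i+1]n-injective : ∀ {i i′} → (2 * i + 1) * n ≡ (2 * i′ + 1) * n → i ≡ i′
  [2i+1]n-injective {i} {i′} eq = *-cancelˡ-≡ i i′ 2 (+-cancelʳ-≡ 1 (2 * i) (2 * i′) (*-cancelʳ-≡ _ _ n eq))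

  sumHoles-unique : ∀ b → Unique (sumHoles b)
  sumHoles-unique b = map⁺ 2jn-injective (sumHoleIndices-unique b)

  diffHoles-unique : Unique diffHoles
  diffHoles-unique = signed-unique (map⁺ [2i+1]n-injective (range-unique 1 (suc k₀))) 0∉
    where
    0∉ : 0 ∉ map (λ i → (2 * i + 1) * n) (range 1 (suc k₀))
    0∉ 0∈ with ∈-map⁻ (λ i → (2 * i + 1) * n) {xs = range 1 (suc k₀)} 0∈
    ... | i , _ , 0≡ = <-irrefl 0≡ (<-≤-trans (<-≤-trans 0<n (m≤n+m n (2 * i * n)))
        (≤-reflexive (sym ([2j+1]n≡2jn+n i))))

  sumRange diffRange : Bool → List ℤ
  sumRange b = interval 0 (top b + top b)
  diffRange b = + 0 ∷ signed (range 1 (top b))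

  ∈-diffRange⁻ : ∀ b {z} → z ∈ diffRange b → ∣ z ∣ ≤ top b
  ∈-diffRange⁻ b (here refl) = z≤n
  ∈-diffRange⁻ b (there z∈) with ∈-range⁻ {1} {top b} (∈-signed⁻ {range 1 (top b)} z∈)
  ... | _ , ∣z∣<1+top = s≤s⁻¹ ∣z∣<1+top

  ∈-diffRange⁺ : ∀ b {z} → ∣ z ∣ ≤ top b → z ∈ diffRange b
  ∈-diffRange⁺ b {+ zero} _ = here refl
  ∈-diffRange⁺ b {+ suc d} ∣z∣≤ = there (∈-signed⁺ {range 1 (top b)} (∈-range⁺ (s≤s z≤n) (s≤s ∣z∣≤)))
  ∈-diffRange⁺ b { -[1+ d ]} ∣z∣≤ = there (∈-signed⁺ {range 1 (top b)} (∈-range⁺ (s≤s z≤n) (s≤s ∣z∣≤)))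

  diffRange-unique : ∀ b → Unique (diffRange b)
  diffRange-unique b = All.tabulate (λ { z∈ refl → 1+n≰n
    (proj₁ (∈-range⁻ {1} {top b} (∈-signed⁻ {range 1 (top b)} z∈))) })
    ∷ signed-unique (range-unique 1 (top b)) (λ 0∈ → 1+n≰n (proj₁ (∈-range⁻ {1} {top b} 0∈)))

  topA≤top : ∀ b → top false ≤ top b
  topA≤top false = ≤-refl
  topA≤top true = topA≤top𝒜

  SumHole⇒≤top+top : ∀ b {j} → SumHole b j → 2 * j * n ≤ top b + top b
  SumHole⇒≤top+top b hole =
    ≤-trans (*-monoˡ-≤ n (*-monoʳ-≤ 2 (SumHole⇒j≤2k+1 hole)))
      (≤-trans (m≤m+n _ (4 * n)) (≤-trans (≤-reflexive (regroup k n)) (+-mono-≤ (topA≤top b) (topA≤top b))))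
    where
    regroup : ∀ k n → 2 * (k + k + 1) * n + 4 * n ≡ 2 * suc k * n + n + (2 * suc k * n + n)
    regroup = solve-∀

  DiffHole⇒≤top : ∀ b {i} → DiffHole i → (2 * i + 1) * n ≤ top b
  DiffHole⇒≤top b (_ , i<k) =
    ≤-trans (*-monoˡ-≤ n (+-monoˡ-≤ 1 (*-monoʳ-≤ 2 (≤-trans (<⇒≤ i<k) (n≤1+n k)))))
      (≤-trans (≤-reflexive ([2j+1]n≡2jn+n (suc k))) (topA≤top b))

  card-sumset : ∀ b → card (sumset (set b)) + length (sumHoles b) ≡ length (sumRange b)
  card-sumset b = card-complement (sumHoles-unique b)
    (interval-unique 0 _) sum∉holes sum∈range hole∈range non-hole⇒sum
    where
    hole⇒SumHole : ∀ {s} → + s ∈ sumHoles b → ∃[ j ] (SumHole b j × s ≡ 2 * j * n)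
    hole⇒SumHole s∈ with ∈-map⁻ (λ j → + (2 * j * n)) {xs = sumHoleIndices b} s∈
    ... | j , j∈ , s≡ = j , ∈-sumHoleIndices⁻ b j∈ , ℤ.+-injective s≡
    sum∉holes : ∀ {z} → z ∈ sumset (set b) → z ∉ sumHoles b
    sum∉holes z∈ z∈H with ∈-sumset⇒IsSum b z∈
    ... | s , refl , is with hole⇒SumHole z∈H
    ...   | j , hole , s≡ = IsSum⇒NotSumHole is j hole s≡
    sum∈range : ∀ {z} → z ∈ sumset (set b) → z ∈ sumRange b
    sum∈range z∈ with ∈-sumset⇒IsSum b z∈
    ... | s , refl , is = ∈-interval⁺ z≤n (IsSum⇒≤ is)
    hole∈range : ∀ {z} → z ∈ sumHoles b → z ∈ sumRange b
    hole∈range z∈ with ∈-map⁻ (λ j → + (2 * j * n)) {xs = sumHoleIndices b} z∈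
    ... | j , j∈ , refl = ∈-interval⁺ z≤n (SumHole⇒≤top+top b (∈-sumHoleIndices⁻ b j∈))
    non-hole⇒sum : ∀ {z} → z ∈ sumRange b → z ∉ sumHoles b → z ∈ sumset (set b)
    non-hole⇒sum z∈ z∉H with ∈-interval⁻ {0} {top b + top b} z∈
    ... | s , _ , s≤ , refl = IsSum⇒∈-sumset b (non-hole⇒IsSum b s≤ not-hole)
      where
      not-hole : NotSumHole b s
      not-hole j hole refl = z∉H (∈-map⁺ (λ j → + (2 * j * n)) (∈-sumHoleIndices⁺ b hole))

  card-diffset : ∀ b → card (diffset (set b)) + length diffHoles ≡ length (diffRange b)
  card-diffset b = card-complement diffHoles-unique
    (diffRange-unique b) diff∉holes diff∈range hole∈range non-hole⇒diff
    where
    hole⇒DiffHole : ∀ {z} → z ∈ diffHoles → ∃[ i ] (DiffHole i × ∣ z ∣ ≡ (2 * i + 1) * n)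
    hole⇒DiffHole z∈ with ∈-map⁻ (λ i → (2 * i + 1) * n) {xs =
      range 1 (suc k₀)} (∈-signed⁻ {map (λ i → (2 * i + 1) * n) (range 1 (suc k₀))} z∈)
    ... | i , i∈ , ∣z∣≡ = i , proj₁ ∈-diffHoleIndices⇔ i∈ , ∣z∣≡
    diff∉holes : ∀ {z} → z ∈ diffset (set b) → z ∉ diffHoles
    diff∉holes z∈ z∈H with hole⇒DiffHole z∈H
    ... | i , hole , ∣z∣≡ = IsDiff⇒NotDiffHole (∈-diffset⇒IsDiff b z∈) i hole ∣z∣≡
    diff∈range : ∀ {z} → z ∈ diffset (set b) → z ∈ diffRange b
    diff∈range z∈ = ∈-diffRange⁺ b (IsDiff⇒≤ (∈-diffset⇒IsDiff b z∈))
    hole∈range : ∀ {z} → z ∈ diffHoles → z ∈ diffRange b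
    hole∈range z∈ with hole⇒DiffHole z∈
    ... | i , hole , ∣z∣≡ = ∈-diffRange⁺ b (subst (_≤ top b) (sym ∣z∣≡) (DiffHole⇒≤top b hole))
    non-hole⇒diff : ∀ {z} → z ∈ diffRange b → z ∉ diffHoles → z ∈ diffset (set b)
    non-hole⇒diff {z} z∈ z∉H = IsDiff⇒∈-diffset b (non-hole⇒IsDiff b (∈-diffRange⁻ b z∈) not-hole)
      where
      not-hole : NotDiffHole ∣ z ∣
      not-hole i hole ∣z∣≡ = z∉H (∈-signed⁺ (subst (_∈ map (λ i → (2 * i + 1) * n) (range 1 (suc k₀)))
        (sym ∣z∣≡) (∈-map⁺ (λ i → (2 * i + 1) * n) (proj₂ ∈-diffHoleIndices⇔ hole))))

  length-sumHoles : ∀ b → length (sumHoles b) ≡ k₀ + (if b then k₀ else suc k₀)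
  length-sumHoles b = trans (length-map _ (sumHoleIndices b))
    (trans (length-++ (range 3 k₀)) (cong₂ _+_ (length-range 3 k₀) (length-range _ _)))

  length-diffHoles : length diffHoles ≡ suc k₀ + suc k₀
  length-diffHoles = trans (length-signed (map (λ i → (2 * i + 1) * n) (range 1 (suc k₀))))
    (cong₂ _+_ length-indices length-indices)
    where
    length-indices = trans (length-map (λ i → (2 * i + 1) * n) (range 1 (suc k₀))) (length-range 1 (suc k₀))

  length-diffRange : ∀ b → length (diffRange b) ≡ suc (top b + top b)
  length-diffRange b = cong suc (trans (length-signed (range 1 (top b)))
    (cong₂ _+_ (length-range 1 (top b)) (length-range 1 (top b))))

  diffHoles-excess : ∀ b → suc k₀ + suc k₀ ≡ k₀ + (if b then k₀ else suc k₀) + (if b then 2 else 1)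
  diffHoles-excess false = regroup k₀
    where
    regroup : ∀ k₀ → suc k₀ + suc k₀ ≡ k₀ + suc k₀ + 1
    regroup = solve-∀
  diffHoles-excess true = regroup k₀
    where
    regroup : ∀ k₀ → suc k₀ + suc k₀ ≡ k₀ + k₀ + 2
    regroup = solve-∀

  |S+S|-|S-S| : ∀ b → + card (sumset (set b)) ℤ.- + card (diffset (set b)) ≡ + (if b then 2 else 1)
  |S+S|-|S-S| b = +a-+b≡+δ {card (sumset (set b))} {card (diffset (set b))} {k₀ + (if b then k₀ else suc k₀)}
    (trans (cong (λ h → card (sumset (set b)) + h) (sym (length-sumHoles b)))
      (trans (card-sumset b) (length-interval 0 _)))
    (trans (cong (λ h → card (diffset (set b)) + h) (sym (trans length-diffHoles (diffHoles-excess b))))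
           (trans (card-diffset b) (length-diffRange b)))

theorem6 : (n k : ℕ) → 1 < n → 1 < k →
    ((+ card (sumset (Construction.A n k)) - + card (diffset (Construction.A n k))) ≡ + 1)
    × ((+ card (sumset (Construction.𝒜 n k)) - + card (diffset (Construction.𝒜 n k))) ≡ + 2)
theorem6 n k 2≤n 2≤k = |S+S|-|S-S| n k 2≤n 2≤k false , |S+S|-|S-S| n k 2≤n 2≤k true
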